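{- For each integer $n\geq 2$, $f(n+1)\geq f(n)^2>f(n)$.
   Context: For a positive integer $n$, let $E_n=\{x_i=1,\ x_i+x_j=x_k,\ x_i\cdot x_j=x_k : i,j,k\in\{1,\ldots,n\}\}$. Let $f(n)$ denote the smallest non-negative integer $b$ such that for each system $S\subseteq E_n$ with a finite number of solutions in integers $x_1,\ldots,x_n$, all these solutions belong to $[-b,b]^n$. -}

module Defs where

open import Data.Nat using (ℕ; _≤_)
open import Data.Integer using (ℤ; +_; _+_; _*_; ∣_∣)
open import Data.Fin using (Fin)
open import Data.Vec using (Vec; lookup)
open import Data.List using (List)
open import Data.List.Relation.Unary.All using (All)
open import Data.List.Membership.Propositional using (_∈_)
open import Data.Product using (Σ; _×_)
open import Relation.Binary.PropositionalEquality using (_≡_)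

data Equation (n : ℕ) : Set where
  one : Fin n → Equation n
  add : Fin n → Fin n → Fin n → Equation n
  mul : Fin n → Fin n → Fin n → Equation n

Sat : {n : ℕ} → Vec ℤ n → Equation n → Set
Sat x (one i)     = lookup x i ≡ + 1
Sat x (add i j k) = lookup x i + lookup x j ≡ lookup x k
Sat x (mul i j k) = lookup x i * lookup x j ≡ lookup x k

-- A system S ⊆ E_n (E_n is finite, so every subset is given by a list)
System : ℕ → Set
System n = List (Equation n)

Solution : {n : ℕ} → System n → Vec ℤ n → Set
Solution S x = All (Sat x) S

FinitelyManySolutions : {n : ℕ} → System n → Set
FinitelyManySolutions {n} S =
  Σ (List (Vec ℤ n)) (λ L → (x : Vec ℤ n) → Solution S x → x ∈ L)

IsBound : ℕ → ℕ → Set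
IsBound n b = (S : System n) → FinitelyManySolutions S →
  (x : Vec ℤ n) → Solution S x → (i : Fin n) → ∣ lookup x i ∣ ≤ b

-- f(n) = b : b is the smallest non-negative integer that is a valid bound
IsF : ℕ → ℕ → Set
IsF n b = IsBound n b × ((c : ℕ) → IsBound n c → b ≤ c)

module Submission where

-- Proof idea.  Let a = f(n) and b = f(n+1), with n ≥ 2.
--
-- * a ≤ √b.  Given a system S on n variables with finitely many solutions,
--   adjoin a fresh variable y together with the equation y = xᵢ·xᵢ.  The
--   solutions of the new system are exactly the solutions x of S extended by
--   y = xᵢ², so there are still finitely many, and the bound b applies to y:
--   |xᵢ|² ≤ b.  Hence if b < a² then every |xᵢ| is at most a - 1, i.e. a - 1
--   is already a valid bound for n variables, contradicting minimality of a.
-- * a ≥ 2.  The system x₀ = 1, x₀ + x₀ = x₁, xⱼ = 1 (j ≥ 2) has the unique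
--   solution (1, 2, 1, …, 1), so every valid bound for n ≥ 2 is at least 2.
-- * Consequently a < a·a.

open import Defs
open import Data.Nat using (ℕ; suc; zero; pred; _*_; _≤_; _<_; s≤s)
open import Data.Nat.Properties
  using (≤-trans; *-mono-≤; <⇒≱; ≰⇒>; ≮⇒≥; <⇒≤pred; 1+n≰n; m<m*n; <⇒≤)
open import Data.Empty using (⊥)
open import Data.Product using (_×_; _,_)
open import Data.Integer as ℤ using (ℤ; +_; ∣_∣)
open import Data.Integer.Properties using (abs-*)
open import Data.Fin as Fin using (Fin)
open import Data.Vec using (Vec; []; _∷_; lookup; replicate)
open import Data.Vec.Properties using (lookup-replicate)
open import Data.List using ([]; _∷_; map; allFin)
open import Data.List.Relation.Unary.All as All using (All; []; _∷_)
open import Data.List.Relation.Unary.All.Properties using (map⁺; map⁻)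
open import Data.List.Relation.Unary.Any using (here)
open import Data.List.Membership.Propositional using (_∈_)
open import Data.List.Membership.Propositional.Properties using (∈-map⁺; ∈-allFin)
open import Relation.Binary.PropositionalEquality using (_≡_; refl; sym; cong; cong₂; subst)

-- An equation in x₀,…,xₙ₋₁ read as an equation in x₁,…,xₙ, leaving room for
-- a fresh variable x₀.
shift : {n : ℕ} → Equation n → Equation (suc n)
shift (one i)     = one (Fin.suc i)
shift (add i j k) = add (Fin.suc i) (Fin.suc j) (Fin.suc k)
shift (mul i j k) = mul (Fin.suc i) (Fin.suc j) (Fin.suc k)

shift-sound : {n : ℕ} (y : ℤ) (x : Vec ℤ n) (e : Equation n) →
  Sat (y ∷ x) (shift e) → Sat x e
shift-sound y x (one i)     p = p
shift-sound y x (add i j k) p = p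
shift-sound y x (mul i j k) p = p

shift-complete : {n : ℕ} (y : ℤ) (x : Vec ℤ n) (e : Equation n) →
  Sat x e → Sat (y ∷ x) (shift e)
shift-complete y x (one i)     p = p
shift-complete y x (add i j k) p = p
shift-complete y x (mul i j k) p = p

withSquare : {n : ℕ} → System n → Fin n → System (suc n)
withSquare S i = mul (Fin.suc i) (Fin.suc i) Fin.zero ∷ map shift S

extendBySquare : {n : ℕ} → Fin n → Vec ℤ n → Vec ℤ (suc n)
extendBySquare i x = lookup x i ℤ.* lookup x i ∷ x

extendBySquare-solution : {n : ℕ} (S : System n) (i : Fin n) (x : Vec ℤ n) →
  Solution S x → Solution (withSquare S i) (extendBySquare i x)
extendBySquare-solution S i x sol =
  refl ∷ map⁺ (All.map (λ {e} → shift-complete _ x e) sol)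

-- Every solution of withSquare S i is the extension of a solution of S, so
-- finitely many solutions of S give finitely many solutions of the extension.
withSquare-finite : {n : ℕ} (S : System n) (i : Fin n) →
  FinitelyManySolutions S → FinitelyManySolutions (withSquare S i)
withSquare-finite S i (L , complete) = map (extendBySquare i) L , solutionsListed
  where
  solutionsListed : (z : Vec ℤ _) → Solution (withSquare S i) z →
    z ∈ map (extendBySquare i) L
  solutionsListed (y ∷ x) (y≡xᵢ² ∷ sol) =
    subst (_∈ map (extendBySquare i) L) (cong (_∷ x) y≡xᵢ²)
      (∈-map⁺ (extendBySquare i) (complete x solᵢ))
    where
    solᵢ : Solution S x
    solᵢ = All.map (λ {e} → shift-sound y x e) (map⁻ sol)

-- If b bounds solutions in n+1 variables, then the square of every entry of
-- a solution in n variables is at most b (apply b to the fresh square).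
square-bounded : {n b : ℕ} → IsBound (suc n) b →
  (S : System n) → FinitelyManySolutions S →
  (x : Vec ℤ n) → Solution S x → (i : Fin n) →
  ∣ lookup x i ∣ * ∣ lookup x i ∣ ≤ b
square-bounded {b = b} bound S fin x sol i =
  subst (_≤ b) (abs-* (lookup x i) (lookup x i))
    (bound (withSquare S i) (withSquare-finite S i fin)
      (extendBySquare i x) (extendBySquare-solution S i x sol) Fin.zero)

bound-below-root : {n b : ℕ} (a : ℕ) → IsBound (suc n) b → b < a * a →
  IsBound n (pred a)
bound-below-root a bound b<a² S fin x sol i =
  <⇒≤pred {n = a} (≰⇒> λ a≤xᵢ →
    <⇒≱ b<a² (≤-trans (*-mono-≤ a≤xᵢ a≤xᵢ) (square-bounded bound S fin x sol i)))

restAreOne : (m : ℕ) → System (suc (suc m))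
restAreOne m = map (λ j → one (Fin.suc (Fin.suc j))) (allFin m)

allOne⇒replicate : {m : ℕ} (r : Vec ℤ m) → ((j : Fin m) → lookup r j ≡ + 1) →
  r ≡ replicate m (+ 1)
allOne⇒replicate []      _   = refl
allOne⇒replicate (y ∷ r) allOne =
  cong₂ _∷_ (allOne Fin.zero) (allOne⇒replicate r (λ j → allOne (Fin.suc j)))

twoSystem : (m : ℕ) → System (suc (suc m))
twoSystem m = one Fin.zero ∷ add Fin.zero Fin.zero (Fin.suc Fin.zero) ∷ restAreOne m

twoSolution : (m : ℕ) → Vec ℤ (suc (suc m))
twoSolution m = + 1 ∷ + 2 ∷ replicate m (+ 1)

twoSolution-solves : (m : ℕ) → Solution (twoSystem m) (twoSolution m)
twoSolution-solves m = refl ∷ refl ∷ map⁺ (All.tabulate (λ {j} _ → lookup-replicate j (+ 1)))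

twoSolution-unique : (m : ℕ) (x : Vec ℤ (suc (suc m))) →
  Solution (twoSystem m) x → x ≡ twoSolution m
twoSolution-unique m (x₀ ∷ x₁ ∷ r) (x₀≡1 ∷ x₀+x₀≡x₁ ∷ rest) =
  cong₂ _∷_ x₀≡1 (cong₂ _∷_ x₁≡2 (allOne⇒replicate r restOne))
  where
  x₁≡2 : x₁ ≡ + 2
  x₁≡2 = subst (λ t → x₁ ≡ t ℤ.+ t) x₀≡1 (sym x₀+x₀≡x₁)
  restOne : (j : Fin m) → lookup r j ≡ + 1
  restOne j = All.lookup (map⁻ rest) (∈-allFin j)

bound-atLeast-two : (m a : ℕ) → IsBound (suc (suc m)) a → 2 ≤ a
bound-atLeast-two m a bound =
  bound (twoSystem m) finite (twoSolution m) (twoSolution-solves m) (Fin.suc Fin.zero)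
  where
  finite : FinitelyManySolutions (twoSystem m)
  finite = twoSolution m ∷ [] , λ x sol → here (twoSolution-unique m x sol)

below-square : {c : ℕ} → 2 ≤ c → c < c * c
below-square {suc c} 2≤c = m<m*n (suc c) (suc c) 2≤c

pred-too-small : {c : ℕ} → 1 ≤ c → c ≤ pred c → ⊥
pred-too-small {suc c} _ = 1+n≰n

lemma3 : (n : ℕ) → 2 ≤ n → (a b : ℕ) → IsF n a → IsF (suc n) b →
    (a * a ≤ b) × (a < a * a)
lemma3 (suc zero) (s≤s ())
lemma3 (suc (suc m)) _ a b (boundA , minimalA) (boundB , _) = a²≤b , a<a²
  where
  2≤a : 2 ≤ a
  2≤a = bound-atLeast-two m a boundA

  a<a² : a < a * a
  a<a² = below-square 2≤a

  -- If b < a² then a - 1 would be a valid bound, contradicting minimality.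
  a²≤b : a * a ≤ b
  a²≤b = ≮⇒≥ λ b<a² → pred-too-small (<⇒≤ 2≤a) (minimalA (pred a) (bound-below-root a boundB b<a²))
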